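{- For every positive integer $n$ there is a planar graph $G$ of maximum degree at most $6$ such that every red/blue coloring of the edges of $G$ contains a monochromatic copy of the path $P_n$. In particular, every path is planar unavoidable, even within the class of planar graphs of maximum degree at most $6$.
   Context: $P_n$ denotes the path on $n$ vertices. A graph $H$ is planar unavoidable if there exists a planar graph $G$ such that every coloring of the edges of $G$ in two colors contains a monochromatic copy of $H$ (a subgraph isomorphic to $H$ with all edges of the same color). -}

module Defs where

open import Data.Nat using (ℕ; suc; _≤_)
open import Data.Fin using (Fin; toℕ)
open import Data.Bool using (Bool; true; false) renaming (_≟_ to _≟B_)
open import Data.List using (List; length; filter; allFin)
open import Data.Product using (Σ; _×_; _,_; ∃)
open import Data.Sum using (_⊎_)
open import Data.Rational using (ℚ; 0ℚ; 1ℚ; _+_; _*_; _-_) renaming (_≤_ to _≤ℚ_)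
open import Relation.Binary.PropositionalEquality using (_≡_; _≢_)
open import Relation.Nullary using (¬_)
open import Function.Definitions using (Injective)

record Graph (N : ℕ) : Set where
  field
    adj      : Fin N → Fin N → Bool
    adj-sym  : ∀ u v → adj u v ≡ adj v u
    adj-irr  : ∀ v → adj v v ≡ false
open Graph public

Adj : ∀ {N} → Graph N → Fin N → Fin N → Set
Adj G u v = adj G u v ≡ true

degree : ∀ {N} → Graph N → Fin N → ℕ
degree {N} G v = length (filter (λ u → adj G v u ≟B true) (allFin N))

MaxDegreeAtMost : ∀ {N} → Graph N → ℕ → Set
MaxDegreeAtMost {N} G d = ∀ (v : Fin N) → degree G v ≤ d

-- Planarity, via straight-line drawings with rational coordinates
-- (equivalent to topological planarity by Fáry's theorem).

Point : Set
Point = ℚ × ℚ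

OnSegment : Point → Point → Point → Set
OnSegment (qx , qy) (px , py) (rx , ry) =
  Σ ℚ λ t → (0ℚ ≤ℚ t) × (t ≤ℚ 1ℚ)
          × (qx ≡ px + t * (rx - px)) × (qy ≡ py + t * (ry - py))

SameEdge : ∀ {N} → Fin N → Fin N → Fin N → Fin N → Set
SameEdge a b c d = ((a ≡ c) × (b ≡ d)) ⊎ ((a ≡ d) × (b ≡ c))

record StraightLineEmbedding {N : ℕ} (G : Graph N) : Set where
  field
    pos        : Fin N → Point
    pos-inj    : Injective _≡_ _≡_ pos
    vertex-off : ∀ w a b → Adj G a b → OnSegment (pos w) (pos a) (pos b) →
                 (w ≡ a) ⊎ (w ≡ b)
    edges-disj : ∀ a b c d → Adj G a b → Adj G c d → ¬ SameEdge a b c d →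
                 ∀ q → OnSegment q (pos a) (pos b) → OnSegment q (pos c) (pos d) →
                 ((q ≡ pos a) ⊎ (q ≡ pos b)) × ((q ≡ pos c) ⊎ (q ≡ pos d))

Planar : ∀ {N} → Graph N → Set
Planar G = StraightLineEmbedding G

record EdgeColouring {N : ℕ} (G : Graph N) : Set where
  field
    colour     : Fin N → Fin N → Bool
    colour-sym : ∀ u v → colour u v ≡ colour v u
open EdgeColouring public

-- a copy of the path P_n (n vertices) in G, all of whose edges have colour c
record MonochromaticPath {N : ℕ} (G : Graph N) (κ : EdgeColouring G) (n : ℕ) : Set where
  field
    vtx      : Fin n → Fin N
    vtx-inj  : Injective _≡_ _≡_ vtx
    col      : Bool
    step     : ∀ (i j : Fin n) → toℕ j ≡ suc (toℕ i) →
               Adj G (vtx i) (vtx j) × (colour κ (vtx i) (vtx j) ≡ col)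

-- The graph is the triangular grid on {0, …, 2n+1}², drawn with straight unit
-- edges (east, north and north-west steps), so it is planar of maximum degree 6.
-- Given a red/blue colouring of its edges, colour each triangular face by the
-- majority of its three sides; the corners of a face of colour c are then joined
-- by c-edges. By the Game of Y, proved with the Schensted–Titus majority
-- reduction (a monochromatic Y of the reduced colouring on the triangle of side m
-- lifts to one of side m + 1), some colour c has a chain of adjacent faces from a
-- face (a, b) with a + b = 2n to both legs of the triangle. This gives c-walks
-- from (a, b) to the line x = 0 and to the line y = 0; since an edge changes each
-- coordinate by at most one, erasing the loops of the walk towards the farther
-- leg leaves a monochromatic path with at least n edges.

module Submission where

open import Defs
open import Data.Bool using (Bool; true; false; _∧_; _∨_)
open import Data.Bool.Properties using (∨-comm; ∧-comm; ∨-zeroʳ) renaming (_≟_ to _≟B_)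
open import Data.Nat using (ℕ; zero; suc)
open import Data.Product using (Σ; _×_; _,_; proj₁; proj₂; uncurry; swap)
import Data.Product
open import Data.Sum using (_⊎_; inj₁; inj₂)
import Data.Sum
open import Data.Empty using (⊥-elim)
open import Function using (_∘_)
open import Relation.Binary.PropositionalEquality
  using (_≡_; _≢_; refl; sym; trans; cong; cong₂; subst; subst₂; module ≡-Reasoning)
open import Relation.Binary.Definitions using (Decidable; DecidableEquality)
open import Relation.Nullary using (¬_; Dec; yes; no; does)
open import Relation.Nullary.Decidable using (dec-true; dec-false)

-- The triangular lattice and its straight-line drawing

Cell : Set
Cell = ℕ × ℕ

data Kind : Set where
  east north northwest : Kind

data Step : Kind → Cell → Cell → Set where
  east      : ∀ {a b} → Step east      (a , b)     (suc a , b)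
  north     : ∀ {a b} → Step north     (a , b)     (a , suc b)
  northwest : ∀ {a b} → Step northwest (suc a , b) (a , suc b)

Adjacent : Cell → Cell → Set
Adjacent p q = Σ Kind λ k → Step k p q ⊎ Step k q p

adjacent-sym : ∀ {p q} → Adjacent p q → Adjacent q p
adjacent-sym (k , inj₁ s) = k , inj₂ s
adjacent-sym (k , inj₂ s) = k , inj₁ s

module Geometry where

  open import Data.Nat as ℕ using (z≤n; s≤s)
  import Data.Nat.Properties as ℕₚ
  open import Data.Rational using (ℚ; 0ℚ; 1ℚ; _+_; _*_; _-_; -_; _≤_; _<_; NonNegative; nonNegative)
  open import Data.Rational.Properties
    using (≤-refl; ≤-trans; ≤-antisym; ≤-reflexive; <⇒≤; <-irrefl; <-≤-trans; positive⁻¹;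
           +-monoʳ-≤; +-monoˡ-≤; +-monoʳ-<; +-identityʳ; *-monoʳ-≤-nonNeg; *-zeroˡ; *-identityˡ;
           neg-antimono-≤; +-inverseʳ; +-0-group)
  open import Data.Rational.Solver using (module +-*-Solver)
  open import Algebra.Properties.Group +-0-group using (∙-cancelˡ; ∙-cancelʳ)
  open import Relation.Binary.Definitions using (tri<; tri≈; tri>)
  open +-*-Solver

  ι : ℕ → ℚ
  ι zero    = 0ℚ
  ι (suc n) = ι n + 1ℚ

  ι<ι-suc : ∀ n → ι n < ι (suc n)
  ι<ι-suc n = subst (_< ι n + 1ℚ) (+-identityʳ (ι n)) (+-monoʳ-< (ι n) (positive⁻¹ 1ℚ))

  ι-mono-≤ : ∀ {a b} → a ℕ.≤ b → ι a ≤ ι b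
  ι-mono-≤ {zero}  {zero}  z≤n     = ≤-refl
  ι-mono-≤ {zero}  {suc b} z≤n     = ≤-trans (ι-mono-≤ {zero} {b} z≤n) (<⇒≤ (ι<ι-suc b))
  ι-mono-≤ {suc a} {suc b} (s≤s h) = +-monoˡ-≤ 1ℚ (ι-mono-≤ h)

  ι-cancel-≤ : ∀ {a b} → ι a ≤ ι b → a ℕ.≤ b
  ι-cancel-≤ {a} {b} h with a ℕ.≤? b
  ... | yes a≤b = a≤b
  ... | no  a≰b = ⊥-elim (<-irrefl refl (<-≤-trans (ι<ι-suc b) (≤-trans (ι-mono-≤ (ℕₚ.≰⇒> a≰b)) h)))

  ι-injective : ∀ {a b} → ι a ≡ ι b → a ≡ b
  ι-injective e = ℕₚ.≤-antisym (ι-cancel-≤ (≤-reflexive e)) (ι-cancel-≤ (≤-reflexive (sym e)))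

  ι-shift : ∀ a b → ι (suc a) + ι b ≡ ι a + ι (suc b)
  ι-shift a b = solve 2 (λ x y → (x :+ con 1ℚ) :+ y := x :+ (y :+ con 1ℚ)) refl (ι a) (ι b)

  infix 4 _∈Unit_

  _∈Unit_ : ℚ → ℕ → Set
  x ∈Unit a = ι a ≤ x × x ≤ ι (suc a)

  ι-∈Unit : ∀ {a c} → ι c ∈Unit a → c ≡ a ⊎ c ≡ suc a
  ι-∈Unit {a} {c} (lo , hi) with c ℕ.≟ suc a
  ... | yes c≡ = inj₂ c≡
  ... | no  c≢ = inj₁ (ℕₚ.≤-antisym (ℕₚ.≤-pred (ℕₚ.≤∧≢⇒< (ι-cancel-≤ hi) c≢)) (ι-cancel-≤ lo))

  ∈Unit-overlap : ∀ {a b x} → x ∈Unit a → x ∈Unit b → a ≡ b ⊎ Σ ℕ λ c → x ≡ ι c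
  ∈Unit-overlap {a} {b} (lo₁ , hi₁) (lo₂ , hi₂) with ℕₚ.<-cmp a b
  ... | tri< a<b _ _ = inj₂ (suc a , ≤-antisym hi₁ (≤-trans (ι-mono-≤ a<b) lo₂))
  ... | tri≈ _ a≡b _ = inj₁ a≡b
  ... | tri> _ _ b<a = inj₂ (suc b , ≤-antisym hi₂ (≤-trans (ι-mono-≤ b<a) lo₁))

  lerp : ℚ → ℚ → ℚ → ℚ
  lerp u v t = u + t * (v - u)

  lerp-const : ∀ u t → lerp u u t ≡ u
  lerp-const = solve 2 (λ u t → u :+ t :* (u :- u) := u) refl

  lerp-+ : ∀ u v u′ v′ t → lerp u v t + lerp u′ v′ t ≡ lerp (u + u′) (v + v′) t
  lerp-+ = solve 5 (λ u v u′ v′ t → (u :+ t :* (v :- u)) :+ (u′ :+ t :* (v′ :- u′))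
                                   := (u :+ u′) :+ t :* ((v :+ v′) :- (u :+ u′))) refl

  lerp-flip : ∀ u v t → lerp u v t ≡ lerp v u (1ℚ - t)
  lerp-flip = solve 3 (λ u v t → u :+ t :* (v :- u) := v :+ (con 1ℚ :- t) :* (u :- v)) refl

  0≤-‿ : ∀ {u v} → u ≤ v → 0ℚ ≤ v - u
  0≤-‿ {u} {v} u≤v = subst (_≤ v - u) (+-inverseʳ u) (+-monoˡ-≤ (- u) u≤v)

  1-‿≤1 : ∀ {t} → 0ℚ ≤ t → 1ℚ - t ≤ 1ℚ
  1-‿≤1 0≤t = +-monoʳ-≤ 1ℚ (neg-antimono-≤ 0≤t)

  lerp-bounds : ∀ {u v t} → 0ℚ ≤ t → t ≤ 1ℚ → u ≤ v → u ≤ lerp u v t × lerp u v t ≤ v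
  lerp-bounds {u} {v} {t} 0≤t t≤1 u≤v = lower , upper
    where
    d = v - u
    instance
      d-nonNeg : NonNegative d
      d-nonNeg = nonNegative (0≤-‿ u≤v)
    lower : u ≤ u + t * d
    lower = subst₂ _≤_ (+-identityʳ u) refl (+-monoʳ-≤ u (subst (_≤ t * d) (*-zeroˡ d) (*-monoʳ-≤-nonNeg d 0≤t)))
    upper : u + t * d ≤ v
    upper = subst (u + t * d ≤_) (solve 2 (λ u v → u :+ (v :- u) := v) refl u v)
                  (+-monoʳ-≤ u (subst (t * d ≤_) (*-identityˡ d) (*-monoʳ-≤-nonNeg d t≤1)))

  onSegment-sym : ∀ {z p q} → OnSegment z p q → OnSegment z q p
  onSegment-sym {x , y} {a , b} {c , d} (t , 0≤t , t≤1 , x≡ , y≡) =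
    1ℚ - t , 0≤-‿ t≤1 , 1-‿≤1 0≤t , trans x≡ (lerp-flip a c t) , trans y≡ (lerp-flip b d t)

  lerp-∈Unit : ∀ {a t} → 0ℚ ≤ t → t ≤ 1ℚ → lerp (ι a) (ι (suc a)) t ∈Unit a
  lerp-∈Unit {a} {t} 0≤t t≤1 = lerp-bounds {ι a} {ι (suc a)} {t} 0≤t t≤1 (<⇒≤ (ι<ι-suc a))

  lerp-∈Unit-rev : ∀ {a t} → 0ℚ ≤ t → t ≤ 1ℚ → lerp (ι (suc a)) (ι a) t ∈Unit a
  lerp-∈Unit-rev {a} {t} 0≤t t≤1 =
    subst (_∈Unit a) (sym (lerp-flip (ι (suc a)) (ι a) t)) (lerp-∈Unit {a} {1ℚ - t} (0≤-‿ t≤1) (1-‿≤1 0≤t))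

  toPoint : Cell → Point
  toPoint (a , b) = ι a , ι b

  toPoint-injective : ∀ {p q} → toPoint p ≡ toPoint q → p ≡ q
  toPoint-injective e = cong₂ _,_ (ι-injective (cong proj₁ e)) (ι-injective (cong proj₂ e))

  Lattice : Point → Set
  Lattice z = Σ Cell λ r → z ≡ toPoint r

  -- One linear equation with integral right-hand side plus unit-interval bounds,
  -- so that the segments of two different steps can only meet in lattice points.
  OnEdge : ∀ {k p q} → Step k p q → Point → Set
  OnEdge (east {a} {b})      (x , y) = x ∈Unit a × y ≡ ι b
  OnEdge (north {a} {b})     (x , y) = x ≡ ι a × y ∈Unit b
  OnEdge (northwest {a} {b}) (x , y) = x ∈Unit a × y ∈Unit b × x + y ≡ ι (suc a) + ι b

  onSegment⇒onEdge : ∀ {k p q z} (s : Step k p q) → OnSegment z (toPoint p) (toPoint q) → OnEdge s z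
  onSegment⇒onEdge (east {a} {b}) (t , 0≤t , t≤1 , x≡ , y≡) =
    subst (_∈Unit a) (sym x≡) (lerp-∈Unit {a} {t} 0≤t t≤1) , trans y≡ (lerp-const (ι b) t)
  onSegment⇒onEdge (north {a} {b}) (t , 0≤t , t≤1 , x≡ , y≡) =
    trans x≡ (lerp-const (ι a) t) , subst (_∈Unit b) (sym y≡) (lerp-∈Unit {b} {t} 0≤t t≤1)
  onSegment⇒onEdge {z = x , y} (northwest {a} {b}) (t , 0≤t , t≤1 , x≡ , y≡) =
    subst (_∈Unit a) (sym x≡) (lerp-∈Unit-rev {a} {t} 0≤t t≤1) ,
    subst (_∈Unit b) (sym y≡) (lerp-∈Unit {b} {t} 0≤t t≤1) ,
    on-line
    where
    open ≡-Reasoning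
    s = ι (suc a) + ι b
    on-line : x + y ≡ s
    on-line = begin
      x + y                                               ≡⟨ cong₂ _+_ x≡ y≡ ⟩
      lerp (ι (suc a)) (ι a) t + lerp (ι b) (ι (suc b)) t ≡⟨ lerp-+ (ι (suc a)) (ι a) (ι b) (ι (suc b)) t ⟩
      lerp s (ι a + ι (suc b)) t                          ≡⟨ cong (λ w → lerp s w t) (ι-shift a b) ⟨
      lerp s s t                                          ≡⟨ lerp-const s t ⟩
      s                                                   ∎

  lattice-on-edge : ∀ {k p q r} (s : Step k p q) → OnEdge s (toPoint r) → r ≡ p ⊎ r ≡ q
  lattice-on-edge {r = X , Y} (east {a} {b}) (x∈ , y≡) with ι-∈Unit {a} {X} x∈ | ι-injective {Y} {b} y≡
  ... | inj₁ refl | refl = inj₁ refl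
  ... | inj₂ refl | refl = inj₂ refl
  lattice-on-edge {r = X , Y} (north {a} {b}) (x≡ , y∈) with ι-injective {X} {a} x≡ | ι-∈Unit {b} {Y} y∈
  ... | refl | inj₁ refl = inj₁ refl
  ... | refl | inj₂ refl = inj₂ refl
  lattice-on-edge {r = X , Y} (northwest {a} {b}) (_ , y∈ , on-line) with ι-∈Unit {b} {Y} y∈
  ... | inj₁ refl = inj₁ (cong (_, Y) (ι-injective (∙-cancelʳ (ι Y) (ι X) (ι (suc a)) on-line)))
  ... | inj₂ refl = inj₂ (cong (_, Y) (ι-injective (∙-cancelʳ (ι Y) (ι X) (ι a) (trans on-line (ι-shift a b)))))

  northwest-x : ∀ {a b c x y} → y ∈Unit b → x + y ≡ ι (suc a) + ι b → y ≡ ι c → Σ ℕ λ X → x ≡ ι X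
  northwest-x {a} {b} {c} {x} y∈ on-line refl with ι-∈Unit {b} {c} y∈
  ... | inj₁ refl = suc a , ∙-cancelʳ (ι c) x (ι (suc a)) on-line
  ... | inj₂ refl = a , ∙-cancelʳ (ι c) x (ι a) (trans on-line (ι-shift a b))

  northwest-y : ∀ {a b c x y} → x ∈Unit a → x + y ≡ ι (suc a) + ι b → x ≡ ι c → Σ ℕ λ Y → y ≡ ι Y
  northwest-y {a} {b} {c} {x} {y} x∈ on-line refl with ι-∈Unit {a} {c} x∈
  ... | inj₁ refl = suc b , ∙-cancelˡ (ι c) y (ι (suc b)) (trans on-line (ι-shift a b))
  ... | inj₂ refl = b , ∙-cancelˡ (ι c) y (ι b) on-line

  steps-meet : ∀ {k k′ p q p′ q′ z} (s : Step k p q) (s′ : Step k′ p′ q′) →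
               ¬ (p ≡ p′ × q ≡ q′) → OnEdge s z → OnEdge s′ z → Lattice z
  steps-meet {z = x , y} (east {a} {b}) (east {a′} {b′}) ne (x∈ , y≡) (x∈′ , y≡′)
    with ∈Unit-overlap {a} {a′} {x} x∈ x∈′ | ι-injective {b} {b′} (trans (sym y≡) y≡′)
  ... | inj₁ refl      | refl = ⊥-elim (ne (refl , refl))
  ... | inj₂ (c , x≡) | _    = (c , b) , cong₂ _,_ x≡ y≡
  steps-meet (east {b = b}) (north {a′}) _ (_ , y≡) (x≡ , _) = (a′ , b) , cong₂ _,_ x≡ y≡
  steps-meet {z = x , y} (east {b = b}) (northwest {a′} {b′}) _ (_ , y≡) (_ , y∈ , on-line)
    with northwest-x {a′} {b′} {b} {x} {y} y∈ on-line y≡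
  ... | X , x≡ = (X , b) , cong₂ _,_ x≡ y≡
  steps-meet north east ne on on′ = steps-meet east north (ne ∘ Data.Product.map sym sym) on′ on
  steps-meet {z = x , y} (north {a} {b}) (north {a′} {b′}) ne (x≡ , y∈) (x≡′ , y∈′)
    with ι-injective {a} {a′} (trans (sym x≡) x≡′) | ∈Unit-overlap {b} {b′} {y} y∈ y∈′
  ... | refl | inj₁ refl      = ⊥-elim (ne (refl , refl))
  ... | _    | inj₂ (c , y≡) = (a , c) , cong₂ _,_ x≡ y≡
  steps-meet {z = x , y} (north {a}) (northwest {a′} {b′}) _ (x≡ , _) (x∈ , _ , on-line)
    with northwest-y {a′} {b′} {a} {x} {y} x∈ on-line x≡
  ... | Y , y≡ = (a , Y) , cong₂ _,_ x≡ y≡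
  steps-meet northwest east ne on on′ = steps-meet east northwest (ne ∘ Data.Product.map sym sym) on′ on
  steps-meet northwest north ne on on′ = steps-meet north northwest (ne ∘ Data.Product.map sym sym) on′ on
  steps-meet {z = x , y} (northwest {a} {b}) (northwest {a′} {b′}) ne (_ , y∈ , on-line) (_ , y∈′ , on-line′)
    with ∈Unit-overlap {b} {b′} {y} y∈ y∈′
  ... | inj₁ refl
    with ι-injective {suc a} {suc a′} (∙-cancelʳ (ι b) (ι (suc a)) (ι (suc a′)) (trans (sym on-line) on-line′))
  ...   | refl = ⊥-elim (ne (refl , refl))
  steps-meet {z = x , y} (northwest {a} {b}) northwest _ (_ , y∈ , on-line) _ | inj₂ (c , y≡)
    with northwest-x {a} {b} {c} {x} {y} y∈ on-line y≡
  ... | X , x≡ = (X , c) , cong₂ _,_ x≡ y≡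

  OnAdjacent : ∀ {p q} → Adjacent p q → Point → Set
  OnAdjacent (_ , inj₁ s) = OnEdge s
  OnAdjacent (_ , inj₂ s) = OnEdge s

  onSegment⇒onAdjacent : ∀ {p q z} (e : Adjacent p q) → OnSegment z (toPoint p) (toPoint q) → OnAdjacent e z
  onSegment⇒onAdjacent (_ , inj₁ s) = onSegment⇒onEdge s
  onSegment⇒onAdjacent {p} {q} {z} (_ , inj₂ s) = onSegment⇒onEdge s ∘ onSegment-sym {z} {toPoint p} {toPoint q}

  lattice-on-adjacent : ∀ {p q r} (e : Adjacent p q) → OnAdjacent e (toPoint r) → r ≡ p ⊎ r ≡ q
  lattice-on-adjacent (_ , inj₁ s) = lattice-on-edge s
  lattice-on-adjacent (_ , inj₂ s) = Data.Sum.swap ∘ lattice-on-edge s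

  SameCells : Cell → Cell → Cell → Cell → Set
  SameCells p q p′ q′ = (p ≡ p′ × q ≡ q′) ⊎ (p ≡ q′ × q ≡ p′)

  adjacent-meet : ∀ {p q p′ q′ z} (e : Adjacent p q) (e′ : Adjacent p′ q′) → ¬ SameCells p q p′ q′ →
                  OnAdjacent e z → OnAdjacent e′ z → Lattice z
  adjacent-meet (_ , inj₁ s) (_ , inj₁ s′) ne = steps-meet s s′ (ne ∘ inj₁)
  adjacent-meet (_ , inj₁ s) (_ , inj₂ s′) ne = steps-meet s s′ (ne ∘ inj₂)
  adjacent-meet (_ , inj₂ s) (_ , inj₁ s′) ne = steps-meet s s′ (ne ∘ inj₂ ∘ swap)
  adjacent-meet (_ , inj₂ s) (_ , inj₂ s′) ne = steps-meet s s′ (ne ∘ inj₁ ∘ swap)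

open import Data.Nat using (_+_; _*_; _≤_; _<_; _≤?_; z≤n; s≤s)
open import Data.Nat.Properties
  using (+-suc; +-identityʳ; ≤-refl; ≤-trans; ≤-reflexive; n≤1+n; +-monoʳ-≤; +-mono-≤; +-mono-<;
         +-cancelʳ-≤; m≤m+n; m≤n+m; <-irrefl; ≰⇒>; suc-injective; module ≤-Reasoning)
  renaming (_≟_ to _≟ℕ_)
open import Data.Nat.DivMod using (_mod_; m%n<n; m<n⇒m%n≡m)
open import Data.Product.Properties using (×-≡,≡→≡)
open import Data.Fin using (Fin; toℕ; inject≤; combine; remQuot)
open import Data.Fin.Properties
  using (toℕ-inject≤; inject≤-injective; toℕ-injective; toℕ-fromℕ<; combine-remQuot; remQuot-combine)
  renaming (_≟_ to _≟F_)
open import Data.List using (List; []; _∷_; length; lookup; filter; allFin)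
open import Data.List.Properties using (filter-none)
open import Data.List.Membership.Propositional using (_∈_)
open import Data.List.Membership.Propositional.Properties using (∈-lookup)
open import Data.List.Relation.Unary.All as All using ([])
open import Data.List.Relation.Unary.All.Properties using (¬Any⇒All¬)
open import Data.List.Relation.Unary.AllPairs using ([]; _∷_)
open import Data.List.Relation.Unary.Any using (here; there)
open import Data.List.Relation.Unary.Linked using (Linked; []; [-]; _∷_)
open import Data.List.Relation.Unary.Unique.Propositional using (Unique)
open import Data.List.Relation.Unary.Unique.Propositional.Properties using (allFin⁺)
open import Relation.Binary.Construct.Closure.ReflexiveTransitive using (Star; ε; _◅_; _◅◅_; return; reverse)

-- The Game of Y

maj : Bool → Bool → Bool → Bool
maj true  y z = y ∨ z
maj false y z = y ∧ z

maj-comm₁₂ : ∀ x y z → maj x y z ≡ maj y x z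
maj-comm₁₂ true  true  z = refl
maj-comm₁₂ true  false z = refl
maj-comm₁₂ false true  z = refl
maj-comm₁₂ false false z = refl

maj-comm₂₃ : ∀ x y z → maj x y z ≡ maj x z y
maj-comm₂₃ true  y z = ∨-comm y z
maj-comm₂₃ false y z = ∧-comm y z

maj-dissent₁ : ∀ x y z {c} → maj x y z ≡ c → x ≢ c → y ≡ c × z ≡ c
maj-dissent₁ true  true  z     refl x≢c = ⊥-elim (x≢c refl)
maj-dissent₁ true  false true  refl x≢c = ⊥-elim (x≢c refl)
maj-dissent₁ true  false false refl x≢c = refl , refl
maj-dissent₁ false true  true  refl x≢c = refl , refl
maj-dissent₁ false true  false refl x≢c = ⊥-elim (x≢c refl)
maj-dissent₁ false false z     refl x≢c = ⊥-elim (x≢c refl)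

maj-dissent₂ : ∀ x y z {c} → maj x y z ≡ c → y ≢ c → x ≡ c × z ≡ c
maj-dissent₂ x y z eq = maj-dissent₁ y x z (trans (sym (maj-comm₁₂ x y z)) eq)

maj-dissent₃ : ∀ x y z {c} → maj x y z ≡ c → z ≢ c → x ≡ c × y ≡ c
maj-dissent₃ x y z eq = maj-dissent₂ x z y (trans (sym (maj-comm₂₃ x y z)) eq)

data Corner : Set where
  base right up : Corner

_≟ᶜ_ : DecidableEquality Corner
base  ≟ᶜ base  = yes refl
base  ≟ᶜ right = no λ ()
base  ≟ᶜ up    = no λ ()
right ≟ᶜ base  = no λ ()
right ≟ᶜ right = yes refl
right ≟ᶜ up    = no λ ()
up    ≟ᶜ base  = no λ ()
up    ≟ᶜ right = no λ ()
up    ≟ᶜ up    = yes refl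

-- A cell p doubles as the triangle with corners p, p + (1, 0) and p + (0, 1).
corner : Cell → Corner → Cell
corner p       base  = p
corner (a , b) right = (suc a , b)
corner (a , b) up    = (a , suc b)

corners-adjacent : ∀ p {k l} → k ≢ l → Adjacent (corner p k) (corner p l)
corners-adjacent p {base}  {base}  k≢l = ⊥-elim (k≢l refl)
corners-adjacent p {base}  {right} k≢l = east , inj₁ east
corners-adjacent p {base}  {up}    k≢l = north , inj₁ north
corners-adjacent p {right} {base}  k≢l = east , inj₂ east
corners-adjacent p {right} {right} k≢l = ⊥-elim (k≢l refl)
corners-adjacent p {right} {up}    k≢l = northwest , inj₁ northwest
corners-adjacent p {up}    {base}  k≢l = north , inj₂ north
corners-adjacent p {up}    {right} k≢l = northwest , inj₂ northwest
corners-adjacent p {up}    {up}    k≢l = ⊥-elim (k≢l refl)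

majority : (Corner → Bool) → Bool
majority f = maj (f base) (f right) (f up)

majority-dissent : ∀ f {c} k l → majority f ≡ c → k ≢ l → f k ≢ c → f l ≡ c
majority-dissent f base  base  _  k≢l = ⊥-elim (k≢l refl)
majority-dissent f base  right eq _   = proj₁ ∘ maj-dissent₁ (f base) (f right) (f up) eq
majority-dissent f base  up    eq _   = proj₂ ∘ maj-dissent₁ (f base) (f right) (f up) eq
majority-dissent f right base  eq _   = proj₁ ∘ maj-dissent₂ (f base) (f right) (f up) eq
majority-dissent f right right _  k≢l = ⊥-elim (k≢l refl)
majority-dissent f right up    eq _   = proj₂ ∘ maj-dissent₂ (f base) (f right) (f up) eq
majority-dissent f up    base  eq _   = proj₁ ∘ maj-dissent₃ (f base) (f right) (f up) eq
majority-dissent f up    right eq _   = proj₂ ∘ maj-dissent₃ (f base) (f right) (f up) eq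
majority-dissent f up    up    _  k≢l = ⊥-elim (k≢l refl)

majority-one-of : ∀ f {c} {l₁ l₂} → majority f ≡ c → l₁ ≢ l₂ → f l₁ ≡ c ⊎ f l₂ ≡ c
majority-one-of f {c} {l₁} {l₂} eq l₁≢l₂ with f l₁ ≟B c
... | yes e = inj₁ e
... | no ne = inj₂ (majority-dissent f l₁ l₂ eq l₁≢l₂ ne)

majority-avoiding : ∀ f {c} → majority f ≡ c → ∀ k → Σ Corner λ l → l ≢ k × f l ≡ c
majority-avoiding f eq base with majority-one-of f {l₁ = right} {up} eq (λ ())
... | inj₁ e = right , (λ ()) , e
... | inj₂ e = up , (λ ()) , e
majority-avoiding f eq right with majority-one-of f {l₁ = base} {up} eq (λ ())
... | inj₁ e = base , (λ ()) , e
... | inj₂ e = up , (λ ()) , e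
majority-avoiding f eq up with majority-one-of f {l₁ = base} {right} eq (λ ())
... | inj₁ e = base , (λ ()) , e
... | inj₂ e = right , (λ ()) , e

level : Cell → ℕ
level (a , b) = a + b

InTriangle : ℕ → Cell → Set
InTriangle m p = level p ≤ m

corner-level : ∀ p {k} → k ≢ base → level (corner p k) ≡ suc (level p)
corner-level p       {base}  k≢base = ⊥-elim (k≢base refl)
corner-level (a , b) {right} _      = refl
corner-level (a , b) {up}    _      = +-suc a b

corner-in-triangle : ∀ {m} p k → InTriangle m p → InTriangle (suc m) (corner p k)
corner-in-triangle p base  h = ≤-trans h (n≤1+n _)
corner-in-triangle {m} p right h = subst (_≤ suc m) (sym (corner-level p {right} λ ())) (s≤s h)
corner-in-triangle {m} p up    h = subst (_≤ suc m) (sym (corner-level p {up} λ ())) (s≤s h)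

corner-proj₁ : ∀ p {k} → k ≢ right → proj₁ (corner p k) ≡ proj₁ p
corner-proj₁ p {base}  _        = refl
corner-proj₁ p {right} k≢right = ⊥-elim (k≢right refl)
corner-proj₁ p {up}    _        = refl

corner-proj₂ : ∀ p {k} → k ≢ up → proj₂ (corner p k) ≡ proj₂ p
corner-proj₂ p {base}  _     = refl
corner-proj₂ p {right} _     = refl
corner-proj₂ p {up}    k≢up = ⊥-elim (k≢up refl)

record Junction (p q : Cell) : Set where
  field
    shared₁ shared₂ : Corner
    shared          : corner p shared₁ ≡ corner q shared₂
    far₁ far₂       : Corner
    far₁≢shared₁    : far₁ ≢ shared₁
    far₂≢shared₂    : far₂ ≢ shared₂
    bridge          : Adjacent (corner p far₁) (corner q far₂)

junction-sym : ∀ {p q} → Junction p q → Junction q p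
junction-sym J = record
  { shared₁ = shared₂ ; shared₂ = shared₁ ; shared = sym shared
  ; far₁ = far₂ ; far₂ = far₁ ; far₁≢shared₁ = far₂≢shared₂ ; far₂≢shared₂ = far₁≢shared₁
  ; bridge = adjacent-sym bridge }
  where open Junction J

junction-step : ∀ {k p q} → Step k p q → Junction p q
junction-step east = record
  { shared₁ = right ; shared₂ = base ; shared = refl ; far₁ = up ; far₂ = up
  ; far₁≢shared₁ = λ () ; far₂≢shared₂ = λ () ; bridge = east , inj₁ east }
junction-step north = record
  { shared₁ = up ; shared₂ = base ; shared = refl ; far₁ = right ; far₂ = right
  ; far₁≢shared₁ = λ () ; far₂≢shared₂ = λ () ; bridge = north , inj₁ north }
junction-step northwest = record
  { shared₁ = up ; shared₂ = right ; shared = refl ; far₁ = base ; far₂ = base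
  ; far₁≢shared₁ = λ () ; far₂≢shared₂ = λ () ; bridge = northwest , inj₁ northwest }

junction : ∀ {p q} → Adjacent p q → Junction p q
junction (_ , inj₁ s) = junction-step s
junction (_ , inj₂ s) = junction-sym (junction-step s)

CellColouring : Set
CellColouring = Cell → Bool

reduce : CellColouring → CellColouring
reduce χ p = majority (χ ∘ corner p)

MonoCell : CellColouring → Bool → ℕ → Cell → Set
MonoCell χ c m p = InTriangle m p × χ p ≡ c

data Walk (χ : CellColouring) (c : Bool) (m : ℕ) : Cell → Cell → Set where
  [_]    : ∀ {p} → MonoCell χ c m p → Walk χ c m p p
  _∷⟨_⟩_ : ∀ {p q r} → MonoCell χ c m p → Adjacent p q → Walk χ c m q r → Walk χ c m p r

infixr 5 _∷⟨_⟩_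

module _ {χ : CellColouring} {c : Bool} {m : ℕ} where

  infixr 5 _++_

  _++_ : ∀ {p q r} → Walk χ c m p q → Walk χ c m q r → Walk χ c m p r
  [ _ ]          ++ w = w
  (h ∷⟨ a ⟩ v) ++ w = h ∷⟨ a ⟩ (v ++ w)

  walk-first : ∀ {p q} → Walk χ c m p q → MonoCell χ c m p
  walk-first [ h ]         = h
  walk-first (h ∷⟨ _ ⟩ _) = h

  walk-last : ∀ {p q} → Walk χ c m p q → MonoCell χ c m q
  walk-last [ h ]         = h
  walk-last (_ ∷⟨ _ ⟩ w) = walk-last w

module Lift (χ : CellColouring) (c : Bool) {m : ℕ} where

  walk-within : ∀ {p k l} → InTriangle m p → χ (corner p k) ≡ c → χ (corner p l) ≡ c →
                Walk χ c (suc m) (corner p k) (corner p l)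
  walk-within {p} {k} {l} h ck cl with k ≟ᶜ l
  ... | yes refl = [ corner-in-triangle p k h , ck ]
  ... | no k≢l   = (corner-in-triangle p k h , ck) ∷⟨ corners-adjacent p k≢l ⟩ [ corner-in-triangle p l h , cl ]

  module _ {p q} (J : Junction p q) where

    open Junction J

    -- Either the shared corner has colour c, or by majority both far corners have it.
    walk-across : ∀ {k} → MonoCell (reduce χ) c m p → MonoCell (reduce χ) c m q → χ (corner p k) ≡ c →
                  Σ Corner λ l → χ (corner q l) ≡ c × Walk χ c (suc m) (corner p k) (corner q l)
    walk-across {k} (hp , rp) (hq , rq) ck with χ (corner p shared₁) ≟B c
    ... | yes cs = shared₂ , subst (λ r → χ r ≡ c) shared cs
                 , subst (Walk χ c (suc m) (corner p k)) shared (walk-within hp ck cs)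
    ... | no ns = far₂ , cf₂ , walk-within hp ck cf₁ ++ cross
      where
      cf₁ : χ (corner p far₁) ≡ c
      cf₁ = majority-dissent (χ ∘ corner p) shared₁ far₁ rp (far₁≢shared₁ ∘ sym) ns
      cf₂ : χ (corner q far₂) ≡ c
      cf₂ = majority-dissent (χ ∘ corner q) shared₂ far₂ rq (far₂≢shared₂ ∘ sym)
                             (ns ∘ subst (λ r → χ r ≡ c) (sym shared))
      cross : Walk χ c (suc m) (corner p far₁) (corner q far₂)
      cross = (corner-in-triangle p far₁ hp , cf₁) ∷⟨ bridge ⟩ [ corner-in-triangle q far₂ hq , cf₂ ]

  lift : ∀ {p q k l} → Walk (reduce χ) c m p q → χ (corner p k) ≡ c → χ (corner q l) ≡ c →
         Walk χ c (suc m) (corner p k) (corner q l)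
  lift [ (h , _) ] ck cl = walk-within h ck cl
  lift (hp ∷⟨ pq ⟩ w) ck cl with walk-across (junction pq) hp (walk-first w) ck
  ... | _ , cl′ , w₁ = w₁ ++ lift w cl′ cl

record MonochromaticY (χ : CellColouring) (m : ℕ) : Set where
  field
    col            : Bool
    apex           : Cell
    left bottom    : Cell
    apex-level     : level apex ≡ m
    left-side      : proj₁ left ≡ 0
    bottom-side    : proj₂ bottom ≡ 0
    apex-to-left   : Walk χ col m apex left
    apex-to-bottom : Walk χ col m apex bottom

lift-Y : ∀ {χ m} → MonochromaticY (reduce χ) m → MonochromaticY χ (suc m)
lift-Y {χ} {m} Y = extend (avoiding apex (walk-first apex-to-left) base)
                          (avoiding left (walk-last apex-to-left) right)
                          (avoiding bottom (walk-last apex-to-bottom) up)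
  where
  open MonochromaticY Y
  open Lift χ col

  Avoiding : Cell → Corner → Set
  Avoiding p k = Σ Corner λ l → l ≢ k × χ (corner p l) ≡ col

  avoiding : ∀ p → MonoCell (reduce χ) col m p → ∀ k → Avoiding p k
  avoiding p (_ , rp) = majority-avoiding (χ ∘ corner p) rp

  extend : Avoiding apex base → Avoiding left right → Avoiding bottom up → MonochromaticY χ (suc m)
  extend (a , a≢base , ca) (l , l≢right , cl) (b , b≢up , cb) = record
    { col            = col
    ; apex           = corner apex a
    ; left           = corner left l
    ; bottom         = corner bottom b
    ; apex-level     = trans (corner-level apex a≢base) (cong suc apex-level)
    ; left-side      = trans (corner-proj₁ left l≢right) left-side
    ; bottom-side    = trans (corner-proj₂ bottom b≢up) bottom-side
    ; apex-to-left   = lift apex-to-left ca cl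
    ; apex-to-bottom = lift apex-to-bottom ca cb
    }

monochromatic-Y : ∀ m χ → MonochromaticY χ m
monochromatic-Y zero χ = record
  { col = χ (0 , 0) ; apex = 0 , 0 ; left = 0 , 0 ; bottom = 0 , 0
  ; apex-level = refl ; left-side = refl ; bottom-side = refl
  ; apex-to-left = [ z≤n , refl ] ; apex-to-bottom = [ z≤n , refl ] }
monochromatic-Y (suc m) χ = lift-Y (monochromatic-Y m (reduce χ))

-- Loop erasure

module Paths {A : Set} (_≟_ : DecidableEquality A) (R : A → A → Set) where

  open import Data.List.Membership.DecPropositional _≟_ using (_∈?_)

  endpoint : A → List A → A
  endpoint x []       = x
  endpoint x (y ∷ ys) = endpoint y ys

  record Path (x y : A) : Set where
    constructor path
    field
      rest     : List A
      linked   : Linked R (x ∷ rest)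
      distinct : Unique (x ∷ rest)
      ends     : endpoint x rest ≡ y

  suffix : ∀ {x y vs} → x ∈ y ∷ vs → Linked R (y ∷ vs) → Unique (y ∷ vs) → Path x (endpoint y vs)
  suffix (here refl) l u = path _ l u refl
  suffix {vs = _ ∷ _} (there x∈vs) (_ ∷ l) (_ ∷ u) = suffix x∈vs l u

  walk⇒path : ∀ {x y} → Star R x y → Path x y
  walk⇒path ε = path [] [-] ([] ∷ []) refl
  walk⇒path {x} (r ◅ w) with walk⇒path w
  ... | path vs l u e with x ∈? _ ∷ vs
  ...   | yes x∈ = subst (Path x) e (suffix x∈ l u)
  ...   | no x∉  = path (_ ∷ vs) (r ∷ l) (¬Any⇒All¬ _ x∉ ∷ u) e

  linked-length : (φ : A → ℕ) → (∀ {u v} → R u v → φ u ≤ suc (φ v)) →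
                  ∀ {x vs} → Linked R (x ∷ vs) → φ x ≤ length vs + φ (endpoint x vs)
  linked-length φ φ-step [-]     = ≤-refl
  linked-length φ φ-step (r ∷ l) = ≤-trans (φ-step r) (s≤s (linked-length φ φ-step l))

  linked-lookup : ∀ {vs : List A} → Linked R vs → ∀ i j → toℕ j ≡ suc (toℕ i) → R (lookup vs i) (lookup vs j)
  linked-lookup (r ∷ _) Fin.zero    (Fin.suc Fin.zero) _ = r
  linked-lookup (_ ∷ l) (Fin.suc i) (Fin.suc j) e = linked-lookup l i j (suc-injective e)

  unique-lookup : ∀ {vs : List A} → Unique vs → ∀ i j → lookup vs i ≡ lookup vs j → i ≡ j
  unique-lookup (_ ∷ _)    Fin.zero    Fin.zero    _ = refl
  unique-lookup (x∉ ∷ _)   Fin.zero    (Fin.suc j) e = ⊥-elim (All.lookup x∉ (∈-lookup j) e)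
  unique-lookup (x∉ ∷ _)   (Fin.suc i) Fin.zero    e = ⊥-elim (All.lookup x∉ (∈-lookup i) (sym e))
  unique-lookup (_ ∷ u)    (Fin.suc i) (Fin.suc j) e = cong Fin.suc (unique-lookup u i j e)

-- The triangular grid graph

count : ∀ {A : Set} → (A → Bool) → List A → ℕ
count f xs = length (filter (λ u → f u ≟B true) xs)

count-∨ : ∀ {A : Set} (f g : A → Bool) xs → count (λ u → f u ∨ g u) xs ≤ count f xs + count g xs
count-∨ f g [] = z≤n
count-∨ f g (x ∷ xs) with f x | g x
... | true  | true  = s≤s (≤-trans (count-∨ f g xs) (+-monoʳ-≤ (count f xs) (n≤1+n _)))
... | true  | false = s≤s (count-∨ f g xs)
... | false | true  = ≤-trans (s≤s (count-∨ f g xs)) (≤-reflexive (sym (+-suc (count f xs) (count g xs))))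
... | false | false = count-∨ f g xs

count-≤1 : ∀ {A : Set} (f : A → Bool) {xs} → Unique xs →
           (∀ {u w} → f u ≡ true → f w ≡ true → u ≡ w) → count f xs ≤ 1
count-≤1 f []                  _     = z≤n
count-≤1 f {x ∷ xs} (x∉ ∷ u) f-det with f x in fx
... | true  = s≤s (≤-reflexive (cong length (filter-none (λ w → f w ≟B true) rest-false)))
  where
  rest-false : All.All (λ w → ¬ f w ≡ true) xs
  rest-false = All.map (λ x≢w fw → x≢w (f-det fx fw)) x∉
... | false = count-≤1 f u f-det

dec-true⁻¹ : ∀ {P : Set} (P? : Dec P) → does P? ≡ true → P
dec-true⁻¹ (yes p) _ = p

∨-split : ∀ {x y} → x ∨ y ≡ true → x ≡ true ⊎ y ≡ true
∨-split {true}  _ = inj₁ refl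
∨-split {false} e = inj₂ e

step? : ∀ k → Decidable (Step k)
step? east (a , b) (c , d) with c ≟ℕ suc a | d ≟ℕ b
... | yes refl | yes refl = yes east
... | no c≢    | _        = no λ { east → c≢ refl }
... | yes _    | no d≢    = no λ { east → d≢ refl }
step? north (a , b) (c , d) with c ≟ℕ a | d ≟ℕ suc b
... | yes refl | yes refl = yes north
... | no c≢    | _        = no λ { north → c≢ refl }
... | yes _    | no d≢    = no λ { north → d≢ refl }
step? northwest (a , b) (c , d) with a ≟ℕ suc c | d ≟ℕ suc b
... | yes refl | yes refl = yes northwest
... | no a≢    | _        = no λ { northwest → a≢ refl }
... | yes _    | no d≢    = no λ { northwest → d≢ refl }

step-irrefl : ∀ {k p} → ¬ Step k p p
step-irrefl ()

step-functional : ∀ {k p q r} → Step k p q → Step k p r → q ≡ r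
step-functional east      east      = refl
step-functional north     north     = refl
step-functional northwest northwest = refl

step-injective : ∀ {k p q r} → Step k p r → Step k q r → p ≡ q
step-injective east      east      = refl
step-injective north     north     = refl
step-injective northwest northwest = refl

isStep : Kind → Cell → Cell → Bool
isStep k p q = does (step? k p q)

link : Kind → Cell → Cell → Bool
link k p q = isStep k p q ∨ isStep k q p

adjacent? : Cell → Cell → Bool
adjacent? p q = link east p q ∨ link north p q ∨ link northwest p q

link-sym : ∀ k p q → link k p q ≡ link k q p
link-sym k p q = ∨-comm (isStep k p q) (isStep k q p)

adjacent?-sym : ∀ p q → adjacent? p q ≡ adjacent? q p
adjacent?-sym p q = cong₂ _∨_ (link-sym east p q) (cong₂ _∨_ (link-sym north p q) (link-sym northwest p q))

link-irrefl : ∀ k p → link k p p ≡ false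
link-irrefl k p rewrite dec-false (step? k p p) step-irrefl = refl

adjacent?-irrefl : ∀ p → adjacent? p p ≡ false
adjacent?-irrefl p rewrite link-irrefl east p | link-irrefl north p | link-irrefl northwest p = refl

link-sound : ∀ k {p q} → link k p q ≡ true → Step k p q ⊎ Step k q p
link-sound k {p} {q} e with ∨-split e
... | inj₁ e₁ = inj₁ (dec-true⁻¹ (step? k p q) e₁)
... | inj₂ e₂ = inj₂ (dec-true⁻¹ (step? k q p) e₂)

link-complete : ∀ {k p q} → Step k p q ⊎ Step k q p → link k p q ≡ true
link-complete {k} {p} {q} (inj₁ s) rewrite dec-true (step? k p q) s = refl
link-complete {k} {p} {q} (inj₂ s) rewrite dec-true (step? k q p) s = ∨-zeroʳ (isStep k p q)

adjacent?-sound : ∀ {p q} → adjacent? p q ≡ true → Adjacent p q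
adjacent?-sound e with ∨-split e
... | inj₁ e₁ = east , link-sound east e₁
... | inj₂ e₂ with ∨-split e₂
...   | inj₁ e₃ = north , link-sound north e₃
...   | inj₂ e₄ = northwest , link-sound northwest e₄

adjacent?-complete : ∀ {p q} → Adjacent p q → adjacent? p q ≡ true
adjacent?-complete         (east , s)      rewrite link-complete s = refl
adjacent?-complete {p} {q} (north , s)     rewrite link-complete s = ∨-zeroʳ (link east p q)
adjacent?-complete {p} {q} (northwest , s) rewrite link-complete s | ∨-zeroʳ (link north p q) = ∨-zeroʳ (link east p q)

Near : ℕ → ℕ → Set
Near a b = a ≤ suc b × b ≤ suc a

near-refl : ∀ a → Near a a
near-refl a = n≤1+n a , n≤1+n a

near-suc : ∀ a → Near a (suc a)
near-suc a = ≤-trans (n≤1+n a) (n≤1+n (suc a)) , ≤-refl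

near-sym : ∀ {a b} → Near a b → Near b a
near-sym (a≤ , b≤) = b≤ , a≤

step-near : ∀ {k p q} → Step k p q → Near (proj₁ p) (proj₁ q) × Near (proj₂ p) (proj₂ q)
step-near (east {a} {b})      = near-suc a , near-refl b
step-near (north {a} {b})     = near-refl a , near-suc b
step-near (northwest {a} {b}) = near-sym (near-suc a) , near-suc b

adjacent-near : ∀ {p q} → Adjacent p q → Near (proj₁ p) (proj₁ q) × Near (proj₂ p) (proj₂ q)
adjacent-near (_ , inj₁ s) = step-near s
adjacent-near (_ , inj₂ s) = Data.Product.map near-sym near-sym (step-near s)

module TriangularGrid (k : ℕ) where

  K N : ℕ
  K = suc k
  N = K * K

  coords : Fin N → Cell
  coords = Data.Product.map toℕ toℕ ∘ remQuot {K} K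

  coords-injective : ∀ {u v} → coords u ≡ coords v → u ≡ v
  coords-injective {u} {v} e = begin
    u                                 ≡⟨ combine-remQuot {K} K u ⟨
    uncurry combine (remQuot {K} K u) ≡⟨ cong (uncurry combine) (×-≡,≡→≡ (toℕ-injective (cong proj₁ e) ,
                                                                            toℕ-injective (cong proj₂ e))) ⟩
    uncurry combine (remQuot {K} K v) ≡⟨ combine-remQuot {K} K v ⟩
    v                                 ∎
    where open ≡-Reasoning

  InGrid : Cell → Set
  InGrid (a , b) = a < K × b < K

  triangle-in-grid : ∀ {p} → InTriangle k p → InGrid p
  triangle-in-grid {a , b} h = s≤s (≤-trans (m≤m+n a b) h) , s≤s (≤-trans (m≤n+m b a) h)

  -- Outside the grid the coordinates wrap around (a junk value that is never used).
  vertex : Cell → Fin N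
  vertex (a , b) = combine (a mod K) (b mod K)

  coords-vertex : ∀ {p} → InGrid p → coords (vertex p) ≡ p
  coords-vertex {a , b} (a<K , b<K) = begin
    coords (combine (a mod K) (b mod K)) ≡⟨ cong (Data.Product.map toℕ toℕ) (remQuot-combine (a mod K) (b mod K)) ⟩
    toℕ (a mod K) , toℕ (b mod K)        ≡⟨ cong₂ _,_ (toℕ-mod a<K) (toℕ-mod b<K) ⟩
    a , b                                ∎
    where
    open ≡-Reasoning
    toℕ-mod : ∀ {x} → x < K → toℕ (x mod K) ≡ x
    toℕ-mod {x} x<K = trans (toℕ-fromℕ< (m%n<n x K)) (m<n⇒m%n≡m x<K)

  grid : Graph N
  grid = record
    { adj     = λ u v → adjacent? (coords u) (coords v)
    ; adj-sym = λ u v → adjacent?-sym (coords u) (coords v)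
    ; adj-irr = λ v → adjacent?-irrefl (coords v)
    }

  adj-grid-vertex : ∀ {p q} → InGrid p → InGrid q → Adjacent p q → Adj grid (vertex p) (vertex q)
  adj-grid-vertex gp gq pq =
    subst₂ (λ r s → adjacent? r s ≡ true) (sym (coords-vertex gp)) (sym (coords-vertex gq)) (adjacent?-complete pq)

  adj-grid-near-x : ∀ {u v} → Adj grid u v → proj₁ (coords u) ≤ suc (proj₁ (coords v))
  adj-grid-near-x {u} {v} uv = proj₁ (proj₁ (adjacent-near (adjacent?-sound {coords u} {coords v} uv)))

  adj-grid-near-y : ∀ {u v} → Adj grid u v → proj₂ (coords u) ≤ suc (proj₂ (coords v))
  adj-grid-near-y {u} {v} uv = proj₁ (proj₂ (adjacent-near (adjacent?-sound {coords u} {coords v} uv)))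

  infix 10 #_

  #_ : (Fin N → Bool) → ℕ
  # f = count f (allFin N)

  link-count : ∀ l p → # (link l p ∘ coords) ≤ 2
  link-count l p = ≤-trans (count-∨ from to (allFin N))
                           (+-mono-≤ (count-≤1 from (allFin⁺ N) outgoing) (count-≤1 to (allFin⁺ N) incoming))
    where
    from to : Fin N → Bool
    from u = isStep l p (coords u)
    to   u = isStep l (coords u) p
    outgoing : ∀ {u w} → isStep l p (coords u) ≡ true → isStep l p (coords w) ≡ true → u ≡ w
    outgoing eu ew = coords-injective (step-functional (dec-true⁻¹ (step? l _ _) eu) (dec-true⁻¹ (step? l _ _) ew))
    incoming : ∀ {u w} → isStep l (coords u) p ≡ true → isStep l (coords w) p ≡ true → u ≡ w
    incoming eu ew = coords-injective (step-injective (dec-true⁻¹ (step? l _ _) eu) (dec-true⁻¹ (step? l _ _) ew))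

  grid-degree : MaxDegreeAtMost grid 6
  grid-degree v = begin
    # (λ u → adjacent? p (coords u))
      ≤⟨ count-∨ (link east p ∘ coords) _ (allFin N) ⟩
    # (link east p ∘ coords) + # (λ u → link north p (coords u) ∨ link northwest p (coords u))
      ≤⟨ +-monoʳ-≤ (# (link east p ∘ coords)) (count-∨ (link north p ∘ coords) _ (allFin N)) ⟩
    # (link east p ∘ coords) + (# (link north p ∘ coords) + # (link northwest p ∘ coords))
      ≤⟨ +-mono-≤ (link-count east p) (+-mono-≤ (link-count north p) (link-count northwest p)) ⟩
    6 ∎
    where
    p = coords v
    open ≤-Reasoning

  open Geometry using (toPoint; toPoint-injective; Lattice; OnAdjacent; onSegment⇒onAdjacent;
                       lattice-on-adjacent; SameCells; adjacent-meet)

  position : Fin N → Point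
  position = toPoint ∘ coords

  grid-planar : Planar grid
  grid-planar = record
    { pos        = position
    ; pos-inj    = coords-injective ∘ toPoint-injective
    ; vertex-off = vertex-off
    ; edges-disj = edges-disj
    }
    where
    vertex-off : ∀ w a b → Adj grid a b → OnSegment (position w) (position a) (position b) → w ≡ a ⊎ w ≡ b
    vertex-off w a b ab on = Data.Sum.map coords-injective coords-injective
      (lattice-on-adjacent carrier (onSegment⇒onAdjacent carrier on))
      where
      carrier = adjacent?-sound {coords a} {coords b} ab

    lattice-endpoint : ∀ {a b z} (e : Adjacent (coords a) (coords b)) → OnAdjacent e z → Lattice z →
                       z ≡ position a ⊎ z ≡ position b
    lattice-endpoint e on (r , refl) = Data.Sum.map (cong toPoint) (cong toPoint) (lattice-on-adjacent {r = r} e on)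

    edges-disj : ∀ a b c d → Adj grid a b → Adj grid c d → ¬ SameEdge a b c d →
                 ∀ z → OnSegment z (position a) (position b) → OnSegment z (position c) (position d) →
                 (z ≡ position a ⊎ z ≡ position b) × (z ≡ position c ⊎ z ≡ position d)
    edges-disj a b c d ab cd ¬same z on₁ on₂ =
      lattice-endpoint {a} {b} e₁ on₁′ meet , lattice-endpoint {c} {d} e₂ on₂′ meet
      where
      e₁ = adjacent?-sound {coords a} {coords b} ab
      e₂ = adjacent?-sound {coords c} {coords d} cd
      on₁′ = onSegment⇒onAdjacent e₁ on₁
      on₂′ = onSegment⇒onAdjacent e₂ on₂
      same-edge : SameCells (coords a) (coords b) (coords c) (coords d) → SameEdge a b c d
      same-edge = Data.Sum.map (Data.Product.map coords-injective coords-injective)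
                               (Data.Product.map coords-injective coords-injective)
      meet = adjacent-meet e₁ e₂ (¬same ∘ same-edge) on₁′ on₂′

-- Monochromatic paths

module Monochromatic {N : ℕ} (G : Graph N) (κ : EdgeColouring G) where

  opposite-colour : (Corner → Fin N) → Corner → Bool
  opposite-colour v base  = colour κ (v right) (v up)
  opposite-colour v right = colour κ (v base) (v up)
  opposite-colour v up    = colour κ (v base) (v right)

  module _ (c : Bool) where

    MonoEdge : Fin N → Fin N → Set
    MonoEdge u v = Adj G u v × colour κ u v ≡ c

    monoEdge-sym : ∀ {u v} → MonoEdge u v → MonoEdge v u
    monoEdge-sym {u} {v} (a , e) = trans (adj-sym G v u) a , trans (colour-sym κ v u) e

    triangle-connected : (v : Corner → Fin N) → (∀ {k l} → k ≢ l → Adj G (v k) (v l)) →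
                         majority (opposite-colour v) ≡ c → ∀ k l → Star MonoEdge (v k) (v l)
    triangle-connected v adj maj≡c = connect
      where
      edge : ∀ {k l} → k ≢ l → colour κ (v k) (v l) ≡ c → Star MonoEdge (v k) (v l)
      edge k≢l e = return (adj k≢l , e)

      dissent : ∀ k l → k ≢ l → opposite-colour v k ≢ c → opposite-colour v l ≡ c
      dissent k l = majority-dissent (opposite-colour v) k l maj≡c

      base-right : Star MonoEdge (v base) (v right)
      base-right with colour κ (v base) (v right) ≟B c
      ... | yes e = edge (λ ()) e
      ... | no ne = edge {base} {up} (λ ()) (dissent up right (λ ()) ne)
                 ◅◅ reverse monoEdge-sym (edge {right} {up} (λ ()) (dissent up base (λ ()) ne))

      base-up : Star MonoEdge (v base) (v up)
      base-up with colour κ (v base) (v up) ≟B c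
      ... | yes e = edge (λ ()) e
      ... | no ne = edge {base} {right} (λ ()) (dissent right up (λ ()) ne)
                 ◅◅ edge {right} {up} (λ ()) (dissent right base (λ ()) ne)

      right-up : Star MonoEdge (v right) (v up)
      right-up with colour κ (v right) (v up) ≟B c
      ... | yes e = edge (λ ()) e
      ... | no ne = reverse monoEdge-sym (edge {base} {right} (λ ()) (dissent base up (λ ()) ne))
                 ◅◅ edge {base} {up} (λ ()) (dissent base right (λ ()) ne)

      connect : ∀ k l → Star MonoEdge (v k) (v l)
      connect base  base  = ε
      connect base  right = base-right
      connect base  up    = base-up
      connect right base  = reverse monoEdge-sym base-right
      connect right right = ε
      connect right up    = right-up
      connect up    base  = reverse monoEdge-sym base-up
      connect up    right = reverse monoEdge-sym right-up
      connect up    up    = ε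

    open Paths _≟F_ MonoEdge

    long-walk⇒path : ∀ {n s t} (φ : Fin N → ℕ) → (∀ {u v} → Adj G u v → φ u ≤ suc (φ v)) →
                     Star MonoEdge s t → n + φ t ≤ φ s → MonochromaticPath G κ (suc n)
    long-walk⇒path {n} {s} φ φ-step w drop with walk⇒path w
    ... | path vs linked distinct refl = record
      { vtx     = vtx
      ; vtx-inj = λ {i} {j} e → inject≤-injective _ _ i j (unique-lookup distinct _ _ e)
      ; col     = c
      ; step    = λ i j j≡1+i → linked-lookup linked _ _
                    (trans (toℕ-inject≤ j _) (trans j≡1+i (cong suc (sym (toℕ-inject≤ i _)))))
      }
      where
      long : n ≤ length vs
      long = +-cancelʳ-≤ _ n (length vs) (≤-trans drop (linked-length φ (φ-step ∘ proj₁) linked))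
      vtx : Fin (suc n) → Fin N
      vtx i = lookup (s ∷ vs) (inject≤ i (s≤s long))

m+n≡o+o⇒o≤m⊎o≤n : ∀ {m n o} → m + n ≡ o + o → o ≤ m ⊎ o ≤ n
m+n≡o+o⇒o≤m⊎o≤n {m} {n} {o} e with o ≤? m | o ≤? n
... | yes o≤m | _       = inj₁ o≤m
... | no _    | yes o≤n = inj₂ o≤n
... | no o≰m  | no o≰n  = ⊥-elim (<-irrefl e (+-mono-< (≰⇒> o≰m) (≰⇒> o≰n)))

module PathInGrid (n : ℕ) (κ : EdgeColouring (TriangularGrid.grid (suc (n + n)))) where

  m : ℕ
  m = n + n

  open TriangularGrid (suc m)
  open Monochromatic grid κ using (MonoEdge; triangle-connected; opposite-colour; long-walk⇒path)

  faceColour : CellColouring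
  faceColour p = majority (opposite-colour (vertex ∘ corner p))

  corner-in-grid : ∀ {p} k → InTriangle m p → InGrid (corner p k)
  corner-in-grid {p} k h = triangle-in-grid (corner-in-triangle p k h)

  face-connected : ∀ {c p} → MonoCell faceColour c m p →
                   ∀ k l → Star (MonoEdge c) (vertex (corner p k)) (vertex (corner p l))
  face-connected {c} {p} (h , e) = triangle-connected c (vertex ∘ corner p) corner-adjacent e
    where
    corner-adjacent : ∀ {k l} → k ≢ l → Adj grid (vertex (corner p k)) (vertex (corner p l))
    corner-adjacent {k} {l} k≢l = adj-grid-vertex (corner-in-grid k h) (corner-in-grid l h) (corners-adjacent p k≢l)

  face-walk : ∀ {c p q} → Walk faceColour c m p q →
              ∀ k l → Star (MonoEdge c) (vertex (corner p k)) (vertex (corner q l))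
  face-walk [ h ] = face-connected h
  face-walk {c} {p} {q} (h ∷⟨ pq ⟩ w) k l =
    face-connected h k shared₁
      ◅◅ subst (λ r → Star (MonoEdge c) (vertex r) (vertex (corner q l))) (sym shared) (face-walk w shared₂ l)
    where open Junction (junction pq)

  module _ (Y : MonochromaticY faceColour m) where

    open MonochromaticY Y

    path-along : (π : Cell → ℕ) → (∀ {u v} → Adj grid u v → π (coords u) ≤ suc (π (coords v))) →
                 ∀ {t} → Walk faceColour col m apex t → π t ≡ 0 → n ≤ π apex →
                 MonochromaticPath grid κ (suc n)
    path-along π π-step {t} w πt≡0 n≤π =
      long-walk⇒path col (π ∘ coords) (λ {u} {v} → π-step {u} {v}) (face-walk w base base) drop
      where
      open ≤-Reasoning
      in-grid : ∀ {r} → MonoCell faceColour col m r → InGrid r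
      in-grid (h , _) = corner-in-grid base h
      drop : n + π (coords (vertex t)) ≤ π (coords (vertex apex))
      drop = begin
        n + π (coords (vertex t)) ≡⟨ cong (λ r → n + π r) (coords-vertex (in-grid (walk-last w))) ⟩
        n + π t                   ≡⟨ cong (n +_) πt≡0 ⟩
        n + 0                     ≡⟨ +-identityʳ n ⟩
        n                         ≤⟨ n≤π ⟩
        π apex                    ≡⟨ cong π (coords-vertex (in-grid (walk-first w))) ⟨
        π (coords (vertex apex))  ∎

    path-from-Y : MonochromaticPath grid κ (suc n)
    path-from-Y with m+n≡o+o⇒o≤m⊎o≤n apex-level
    ... | inj₁ n≤x = path-along proj₁ (λ {u} {v} → adj-grid-near-x {u} {v}) apex-to-left   left-side   n≤x
    ... | inj₂ n≤y = path-along proj₂ (λ {u} {v} → adj-grid-near-y {u} {v}) apex-to-bottom bottom-side n≤y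

  monochromatic-path : MonochromaticPath grid κ (suc n)
  monochromatic-path = path-from-Y (monochromatic-Y m faceColour)

corollary1 : (n : ℕ) → Σ ℕ λ N → Σ (Graph N) λ G →
    Planar G × MaxDegreeAtMost G 6 ×
    ((κ : EdgeColouring G) → MonochromaticPath G κ (suc n))
corollary1 n = N , grid , grid-planar , grid-degree , PathInGrid.monochromatic-path n
  where open TriangularGrid (suc (n + n))
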